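{- There is a propagation-complete CNF encoding of the constraint $\mathsf{AtMostOne}(x_1,\dots,x_n)$ using $2n + 2\sqrt{2n} + O(\sqrt[3]{n})$ clauses and $\sqrt{2n} + O(\sqrt[3]{n})$ auxiliary variables (asymptotics as $n \to \infty$).
   Context: $\mathsf{AtMostOne}(x_1,\dots,x_n)$ is the Boolean function that is true iff at most one of $x_1,\dots,x_n$ is true. A CNF formula is a set of clauses (each a set of literals); its size is its number of clauses. For a partial assignment $\tau$ and CNF $\varphi$, $\varphi|_\tau$ is obtained by deleting every clause satisfied by $\tau$ and deleting from the remaining clauses every literal falsified by $\tau$. A CNF $\varphi$ over variables $X \sqcup Y$, with $X=(x_1,\dots,x_n)$, encodes $f:\{\bot,\top\}^n\to\{\bot,\top\}$ if for every assignment $\tau$ of $X$, $f(\tau(x_1),\dots,\tau(x_n))=\top$ iff $\varphi|_\tau$ is satisfiable; variables of $Y$ are auxiliary. Such an encoding is propagation complete if for all literals $\ell_1,\dots,\ell_m$ over $X$: whenever $\varphi\wedge\bigwedge_{i<m}\ell_i \models \ell_m$, either $\ell_m$ or the empty clause can be derived from $\varphi\wedge\bigwedge_{i<m}\ell_i$ by unit propagation. -}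

module Defs where

open import Data.Nat using (ℕ)
open import Data.Fin using (Fin)
open import Data.Bool using (Bool; true; false; not; _xor_; if_then_else_)
open import Data.Sum using (_⊎_; inj₁; inj₂)
open import Data.Product using (_×_; _,_; Σ; ∃)
open import Data.Maybe using (Maybe; just; nothing)
import Data.Maybe as Maybe
open import Data.List using (List; []; _∷_; [_]; _++_; map; mapMaybe)
open import Data.List.Membership.Propositional using (_∈_)
open import Data.List.Relation.Unary.All using (All)
open import Data.List.Relation.Unary.Any using (Any)
open import Relation.Binary.PropositionalEquality using (_≡_; _≢_)

AtMostOne : (n : ℕ) → (Fin n → Bool) → Set
AtMostOne n τ = ∀ i j → τ i ≡ true → τ j ≡ true → i ≡ j

-- Variables of a CNF with n input variables X and m auxiliary variables Y.
Var : ℕ → ℕ → Set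
Var n m = Fin n ⊎ Fin m

-- A literal over a variable type V: a variable with a polarity
-- (true = positive literal v, false = negative literal ¬v).
Lit : Set → Set
Lit V = V × Bool

neg : ∀ {V : Set} → Lit V → Lit V
neg (v , b) = (v , not b)

LitTrue : ∀ {V : Set} → (V → Bool) → Lit V → Set
LitTrue α (v , b) = α v ≡ b

Clause : Set → Set
Clause V = List (Lit V)

-- CNF formula: a finite collection of clauses; its size is the number of
-- clauses (the length of the list).
CNF : Set → Set
CNF V = List (Clause V)

SatClause : ∀ {V : Set} → (V → Bool) → Clause V → Set
SatClause α C = Any (LitTrue α) C

Sat : ∀ {V : Set} → (V → Bool) → CNF V → Set
Sat α φ = All (SatClause α) φ

Satisfiable : ∀ {V : Set} → CNF V → Set
Satisfiable {V} φ = Σ (V → Bool) λ α → Sat α φ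

-- Restriction of a clause by an assignment τ of X:
-- nothing      if the clause is satisfied by τ (clause deleted),
-- just C'      otherwise, C' = the clause with the X-literals (all falsified) removed.
restrictClause : ∀ {n m} → (Fin n → Bool) → Clause (Var n m) → Maybe (Clause (Fin m))
restrictClause τ [] = just []
restrictClause τ ((inj₁ x , b) ∷ C) =
  if τ x xor b then restrictClause τ C else nothing
restrictClause τ ((inj₂ y , b) ∷ C) = Maybe.map ((y , b) ∷_) (restrictClause τ C)

restrict : ∀ {n m} → (Fin n → Bool) → CNF (Var n m) → CNF (Fin m)
restrict τ φ = mapMaybe (restrictClause τ) φ

Encodes : ∀ {n m} → ((Fin n → Bool) → Set) → CNF (Var n m) → Set
Encodes {n} f φ = (τ : Fin n → Bool) → (f τ → Satisfiable (restrict τ φ)) × (Satisfiable (restrict τ φ) → f τ)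

liftLit : ∀ {n m} → Lit (Fin n) → Lit (Var n m)
liftLit (x , b) = (inj₁ x , b)

Entails : ∀ {V : Set} → CNF V → List (Lit V) → Lit V → Set
Entails {V} φ L ℓ = (α : V → Bool) → Sat α φ → All (LitTrue α) L → LitTrue α ℓ

-- Unit propagation on a CNF ψ: the literals derivable by (repeated) unit resolution.
data UP⊢ {V : Set} (ψ : CNF V) : Lit V → Set where
  unit : ∀ {C ℓ} → C ∈ ψ → ℓ ∈ C →
         (∀ {ℓ′} → ℓ′ ∈ C → ℓ′ ≢ ℓ → UP⊢ ψ (neg ℓ′)) → UP⊢ ψ ℓ

UP⊢□ : ∀ {V : Set} → CNF V → Set
UP⊢□ ψ = ∃ λ C → C ∈ ψ × (∀ {ℓ} → ℓ ∈ C → UP⊢ ψ (neg ℓ))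

addUnits : ∀ {V : Set} → CNF V → List (Lit V) → CNF V
addUnits φ L = φ ++ map [_] L

PropagationComplete : ∀ {n m} → CNF (Var n m) → Set
PropagationComplete {n} {m} φ =
  (L : List (Lit (Fin n))) (ℓ : Lit (Fin n)) →
  Entails φ (map liftLit L) (liftLit ℓ) →
  UP⊢ (addUnits φ (map liftLit L)) (liftLit ℓ) ⊎ UP⊢□ (addUnits φ (map liftLit L))

-- Each input xᵢ is sent to a pair (aᵢ , bᵢ) of auxiliary variables y from two different
-- blocks, by the clauses xᵢ → y aᵢ and xᵢ → y bᵢ. The y's of a block form a w × w grid, and
-- the y in row r and column c of block B implies the mark at position (B , r) of a row ladder
-- and at position (B , c) of a column ladder; a ladder is a sequential counter in which unit
-- propagation falsifies every other mark as soon as two marks are true. So a true xᵢ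
-- propagates to the marks of aᵢ and bᵢ, then to ¬ y for every other y (as aᵢ and bᵢ lie in
-- different blocks, such a y misses both marks on one of the two ladders), then to ¬ xⱼ for
-- every j ≢ i (one endpoint of its pair is neither aᵢ nor bᵢ). Since moreover every assignment
-- with at most one true input extends to a model, the encoding is propagation complete. With
-- about √(2n) y's in blocks of about r cells, the ladders have O(r) positions, giving
-- 2n + 2√(2n) + O(r) clauses and √(2n) + O(r) auxiliary variables.

module Submission where

open import Defs
open import Data.Bool using (Bool; true; false)
import Data.Bool.Properties as Bool
open import Data.Empty using (⊥-elim)
open import Data.Fin as Fin using (Fin; toℕ)
import Data.Fin.Properties as Fin
open import Data.List using (List; []; _∷_; [_]; _++_; map; length; tabulate)
open import Data.List.Membership.Propositional using (_∈_; _∉_; find; lose)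
open import Data.List.Membership.Propositional.Properties
  using (∈-map⁺; ∈-map⁻; ∈-++⁺ˡ; ∈-++⁺ʳ; ∈-++⁻; ∈-tabulate⁺)
open import Data.List.Properties using (map-++; length-++; length-map; length-tabulate)
open import Data.List.Relation.Binary.Subset.Propositional using (_⊆_)
open import Data.List.Relation.Unary.All as All using (All; []; _∷_)
import Data.List.Relation.Unary.All.Properties as All
open import Data.List.Relation.Unary.Any as Any using (Any; here; there; _─_; any?)
import Data.List.Relation.Unary.Any.Properties as Any
open import Data.Maybe using (just; nothing)
open import Data.Nat as ℕ
  using (ℕ; NonZero; zero; suc; _+_; _*_; _⊓_; _≤_; _<_; _≤′_; ≤′-refl; ≤′-step; z≤n; s≤s)
open import Data.Nat.DivMod using (_mod_; _/_; _%_; m<n⇒m%n≡m; m≡m%n+[m/n]*n; m%n≤n; m/n*n≤m)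
open import Data.Nat.Properties as ℕ
  using (n<1+n; n≤1+n; ≤-refl; ≤-trans; ≤-pred; ≤⇒≤′; <-irrefl; <-cmp; module ≤-Reasoning)
open import Data.Nat.Tactic.RingSolver using (solve-∀)
open import Data.Product as Product using (Σ; ∃; ∃₂; _×_; _,_; proj₁; proj₂)
open import Data.Product.Function.NonDependent.Propositional using (_×-↔_)
open import Data.Product.Properties using (≡-dec)
open import Data.Sum as Sum using (_⊎_; inj₁; inj₂)
open import Data.Sum.Function.Propositional using (_⊎-↔_)
open import Function using (_∘_)
open import Function.Bundles using (_↔_; _↣_; _⇔_; Inverse; Injection; Equivalence; mk⇔)
open import Function.Properties.Inverse using (↔⇒↣; ↔-refl; ↔-sym; ↔-trans)
open import Relation.Binary.Definitions using (DecidableEquality; tri<; tri≈; tri>)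
open import Relation.Binary.PropositionalEquality using (_≡_; _≢_; refl; sym; trans; cong; cong₂; subst; subst₂)
open import Relation.Nullary using (¬_; Dec; yes; no; does; contradiction)
open import Relation.Nullary.Decidable as Dec using (_×-dec_; _⊎-dec_; ¬?)

-- Unit propagation

∈-─⁺ : ∀ {A : Set} {x y : A} {xs} (x∈xs : x ∈ xs) → y ∈ xs → y ≢ x → y ∈ (xs ─ x∈xs)
∈-─⁺ (here refl)  (here refl)  y≢x = contradiction refl y≢x
∈-─⁺ (here refl)  (there y∈xs) _   = y∈xs
∈-─⁺ (there x∈xs) (here refl)  _   = here refl
∈-─⁺ (there x∈xs) (there y∈xs) y≢x = there (∈-─⁺ x∈xs y∈xs y≢x)

does⇔ : ∀ {P : Set} (P? : Dec P) → does P? ≡ true ⇔ P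
does⇔ (yes p) = mk⇔ (λ _ → p) (λ _ → refl)
does⇔ (no ¬p) = mk⇔ (λ ()) (λ p → contradiction p ¬p)

module _ {V : Set} where

  propagate : ∀ {ψ : CNF V} {C ℓ} → C ∈ ψ → (ℓ∈C : ℓ ∈ C) →
              All (λ ℓ′ → UP⊢ ψ (neg ℓ′)) (C ─ ℓ∈C) → UP⊢ ψ ℓ
  propagate C∈ψ ℓ∈C others = unit C∈ψ ℓ∈C (λ ℓ′∈C ℓ′≢ℓ → All.lookup others (∈-─⁺ ℓ∈C ℓ′∈C ℓ′≢ℓ))

  UP⊢-unit : ∀ {ψ : CNF V} {ℓ} → [ ℓ ] ∈ ψ → UP⊢ ψ ℓ
  UP⊢-unit [ℓ]∈ψ = propagate [ℓ]∈ψ (here refl) []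

  UP⊢□-unit : ∀ {ψ : CNF V} {ℓ} → [ ℓ ] ∈ ψ → UP⊢ ψ (neg ℓ) → UP⊢□ ψ
  UP⊢□-unit [ℓ]∈ψ ¬ℓ = _ , [ℓ]∈ψ , λ { (here refl) → ¬ℓ }

  UP⊢-mono : ∀ {ψ ψ′ : CNF V} {ℓ} → ψ ⊆ ψ′ → UP⊢ ψ ℓ → UP⊢ ψ′ ℓ
  UP⊢-mono ψ⊆ψ′ (unit C∈ψ ℓ∈C others) = unit (ψ⊆ψ′ C∈ψ) ℓ∈C (λ ℓ′∈C ℓ′≢ℓ → UP⊢-mono ψ⊆ψ′ (others ℓ′∈C ℓ′≢ℓ))

  UP⊢-sound : ∀ {ψ : CNF V} {α ℓ} → Sat α ψ → UP⊢ ψ ℓ → LitTrue α ℓ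
  UP⊢-sound {α = α} {ℓ = v , b} sat (unit C∈ψ ℓ∈C others) with α v Bool.≟ b
  ... | yes αv≡b = αv≡b
  ... | no αv≢b with find (All.lookup sat C∈ψ)
  ... | ℓ′ , ℓ′∈C , ℓ′-true = ⊥-elim (Bool.not-¬ ℓ′-true (UP⊢-sound sat (others ℓ′∈C ℓ′≢ℓ)))
    where
    ℓ′≢ℓ : ℓ′ ≢ (v , b)
    ℓ′≢ℓ refl = αv≢b ℓ′-true

  infix 6 _⇒_

  _⇒_ : V → V → Clause V
  a ⇒ b = (a , false) ∷ (b , true) ∷ []

  modus-ponens : ∀ {ψ a b} → (a ⇒ b) ∈ ψ → UP⊢ ψ (a , true) → UP⊢ ψ (b , true)
  modus-ponens a⇒b∈ψ a = propagate a⇒b∈ψ (there (here refl)) (a ∷ [])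

  modus-tollens : ∀ {ψ a b} → (a ⇒ b) ∈ ψ → UP⊢ ψ (b , false) → UP⊢ ψ (a , false)
  modus-tollens a⇒b∈ψ ¬b = propagate a⇒b∈ψ (here refl) (¬b ∷ [])

  SatClause-⇒ : ∀ {α : V → Bool} {a b} → (α a ≡ true → α b ≡ true) → SatClause α (a ⇒ b)
  SatClause-⇒ {α} {a} a→b with α a in αa
  ... | false = here αa
  ... | true  = there (here (a→b refl))

  HasNegative : Clause V → Set
  HasNegative = Any ((_≡ false) ∘ proj₂)

  Sat-allFalse : ∀ {α : V → Bool} {φ} → (∀ v → α v ≡ false) → All HasNegative φ → Sat α φ
  Sat-allFalse α≡false = All.map (Any.map λ { {v , _} refl → α≡false v })

-- Renaming and restriction

module _ {V W : Set} (ρ : V → W) where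

  renameLit : Lit V → Lit W
  renameLit (v , b) = ρ v , b

  renameClause : Clause V → Clause W
  renameClause = map renameLit

  rename : CNF V → CNF W
  rename = map renameClause

  UP⊢-rename : ∀ {ψ ℓ} → UP⊢ ψ ℓ → UP⊢ (rename ψ) (renameLit ℓ)
  UP⊢-rename {ψ} {ℓ} (unit {C} C∈ψ ℓ∈C others) =
    unit (∈-map⁺ renameClause C∈ψ) (∈-map⁺ renameLit ℓ∈C) others′
    where
    others′ : ∀ {ℓ′} → ℓ′ ∈ renameClause C → ℓ′ ≢ renameLit ℓ → UP⊢ (rename ψ) (neg ℓ′)
    others′ ℓ′∈ ℓ′≢ with ∈-map⁻ renameLit ℓ′∈
    ... | ℓ″ , ℓ″∈C , refl = UP⊢-rename (others ℓ″∈C (ℓ′≢ ∘ cong renameLit))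

  Sat-rename : ∀ {α : W → Bool} {α′ : V → Bool} → (∀ v → α (ρ v) ≡ α′ v) →
               ∀ {φ} → Sat α′ φ → Sat α (rename φ)
  Sat-rename α∘ρ≗α′ = All.map⁺ ∘ All.map (Any.map⁺ ∘ Any.map λ {(v , b)} α′v≡b → trans (α∘ρ≗α′ v) α′v≡b)

module _ {n m : ℕ} (τ : Fin n → Bool) (β : Fin m → Bool) where

  private
    α : Var n m → Bool
    α = Sum.[ τ , β ]

  SatClause-restrict-nothing : ∀ C → restrictClause τ C ≡ nothing → SatClause α C
  SatClause-restrict-nothing ((inj₁ x , true) ∷ C) eq with τ x in τx
  ... | true  = here τx
  ... | false = there (SatClause-restrict-nothing C eq)
  SatClause-restrict-nothing ((inj₁ x , false) ∷ C) eq with τ x in τx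
  ... | true  = there (SatClause-restrict-nothing C eq)
  ... | false = here τx
  SatClause-restrict-nothing ((inj₂ y , b) ∷ C) eq with restrictClause τ C in eq′
  ... | nothing = there (SatClause-restrict-nothing C eq′)

  SatClause-restrict⁺ : ∀ C {C′} → restrictClause τ C ≡ just C′ → SatClause α C → SatClause β C′
  SatClause-restrict⁺ ((inj₁ x , true) ∷ C) eq sat with τ x in τx
  SatClause-restrict⁺ ((inj₁ x , true) ∷ C) eq (here τx≡true) | false = contradiction (trans (sym τx) τx≡true) λ ()
  SatClause-restrict⁺ ((inj₁ x , true) ∷ C) eq (there sat)    | false = SatClause-restrict⁺ C eq sat
  SatClause-restrict⁺ ((inj₁ x , false) ∷ C) eq sat with τ x in τx
  SatClause-restrict⁺ ((inj₁ x , false) ∷ C) eq (here τx≡false) | true = contradiction (trans (sym τx) τx≡false) λ ()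
  SatClause-restrict⁺ ((inj₁ x , false) ∷ C) eq (there sat)     | true  = SatClause-restrict⁺ C eq sat
  SatClause-restrict⁺ ((inj₂ y , b) ∷ C) eq sat with restrictClause τ C in eq′
  SatClause-restrict⁺ ((inj₂ y , b) ∷ C) refl (here βy≡b) | just C′ = here βy≡b
  SatClause-restrict⁺ ((inj₂ y , b) ∷ C) refl (there sat) | just C′ = there (SatClause-restrict⁺ C eq′ sat)

  SatClause-restrict⁻ : ∀ C {C′} → restrictClause τ C ≡ just C′ → SatClause β C′ → SatClause α C
  SatClause-restrict⁻ [] refl ()
  SatClause-restrict⁻ ((inj₁ x , true) ∷ C) eq sat with τ x
  ... | false = there (SatClause-restrict⁻ C eq sat)
  SatClause-restrict⁻ ((inj₁ x , false) ∷ C) eq sat with τ x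
  ... | true = there (SatClause-restrict⁻ C eq sat)
  SatClause-restrict⁻ ((inj₂ y , b) ∷ C) eq sat with restrictClause τ C in eq′
  SatClause-restrict⁻ ((inj₂ y , b) ∷ C) refl (here βy≡b) | just C′ = here βy≡b
  SatClause-restrict⁻ ((inj₂ y , b) ∷ C) refl (there sat) | just C′ = there (SatClause-restrict⁻ C eq′ sat)

  Sat-restrict⁺ : ∀ φ → Sat α φ → Sat β (restrict τ φ)
  Sat-restrict⁺ [] [] = []
  Sat-restrict⁺ (C ∷ φ) (satC ∷ sat) with restrictClause τ C in eq
  ... | just C′ = SatClause-restrict⁺ C eq satC ∷ Sat-restrict⁺ φ sat
  ... | nothing = Sat-restrict⁺ φ sat

  Sat-restrict⁻ : ∀ φ → Sat β (restrict τ φ) → Sat α φ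
  Sat-restrict⁻ [] _ = []
  Sat-restrict⁻ (C ∷ φ) sat with restrictClause τ C in eq
  Sat-restrict⁻ (C ∷ φ) (satC′ ∷ sat) | just C′ = SatClause-restrict⁻ C eq satC′ ∷ Sat-restrict⁻ φ sat
  Sat-restrict⁻ (C ∷ φ) sat | nothing = SatClause-restrict-nothing C eq ∷ Sat-restrict⁻ φ sat

-- Propagation-complete encodings of AtMostOne

module _ {n : ℕ} {A : Set} where

  ExtendsAtMostOne : CNF (Fin n ⊎ A) → Set
  ExtendsAtMostOne φ = ∀ τ → AtMostOne n τ → ∃ λ β → Sat Sum.[ τ , β ] φ

  PropagatesAtMostOne : CNF (Fin n ⊎ A) → Set
  PropagatesAtMostOne φ = ∀ {i j} → i ≢ j → UP⊢ (φ ++ [ [ (inj₁ i , true) ] ]) (inj₁ j , false)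

module _ {n : ℕ} {A B : Set} (A↔B : A ↔ B) {φ : CNF (Fin n ⊎ A)} where

  open Inverse A↔B using (to; from; strictlyInverseʳ)

  ExtendsAtMostOne-rename : ExtendsAtMostOne φ → ExtendsAtMostOne (rename (Sum.map₂ to) φ)
  ExtendsAtMostOne-rename extends τ amo with extends τ amo
  ... | β , sat = β ∘ from , Sat-rename (Sum.map₂ to) agree sat
    where
    agree : ∀ v → Sum.[ τ , β ∘ from ] (Sum.map₂ to v) ≡ Sum.[ τ , β ] v
    agree (inj₁ x) = refl
    agree (inj₂ a) = cong β (strictlyInverseʳ a)

  PropagatesAtMostOne-rename : PropagatesAtMostOne φ → PropagatesAtMostOne (rename (Sum.map₂ to) φ)
  PropagatesAtMostOne-rename propagates i≢j =
    subst (λ ψ → UP⊢ ψ _) (map-++ (renameClause (Sum.map₂ to)) φ _) (UP⊢-rename (Sum.map₂ to) (propagates i≢j))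

module _ {n m : ℕ} {φ : CNF (Var n m)} (extends : ExtendsAtMostOne φ) (propagates : PropagatesAtMostOne φ) where

  Encodes-AtMostOne : Encodes (AtMostOne n) φ
  Encodes-AtMostOne τ = satisfiable , atMostOne
    where
    satisfiable : AtMostOne n τ → Satisfiable (restrict τ φ)
    satisfiable amo with extends τ amo
    ... | β , sat = β , Sat-restrict⁺ τ β φ sat

    atMostOne : Satisfiable (restrict τ φ) → AtMostOne n τ
    atMostOne (β , sat) i j τi τj with i Fin.≟ j
    ... | yes i≡j = i≡j
    ... | no i≢j = contradiction (trans (sym τj) τj≡false) λ ()
      where
      τj≡false : τ j ≡ false
      τj≡false = UP⊢-sound (All.++⁺ (Sat-restrict⁻ τ β φ sat) (here τi ∷ [])) (propagates i≢j)

  private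
    only : Fin n → Fin n → Bool
    only i x = does (x Fin.≟ i)

    only-true : ∀ {i x} → only i x ≡ true → x ≡ i
    only-true {i} {x} eq with x Fin.≟ i
    ... | yes x≡i = x≡i

    only-self : ∀ i → only i i ≡ true
    only-self i with i Fin.≟ i
    ... | yes _ = refl
    ... | no i≢i = contradiction refl i≢i

    only-AtMostOne : ∀ i → AtMostOne n (only i)
    only-AtMostOne i x y ox oy = trans (only-true ox) (sym (only-true oy))

    _∈?_ : ∀ (ℓ : Lit (Fin n)) L → Dec (ℓ ∈ L)
    ℓ ∈? L = any? (≡-dec Fin._≟_ Bool._≟_ ℓ) L

    OtherPositive : Fin n → List (Lit (Fin n)) → Set
    OtherPositive j L = ∃ λ i → i ≢ j × (i , true) ∈ L

    otherPositive? : ∀ j L → Dec (OtherPositive j L)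
    otherPositive? j L = Dec.map′ fromAny toAny (any? (λ ℓ → (proj₂ ℓ Bool.≟ true) ×-dec ¬? (proj₁ ℓ Fin.≟ j)) L)
      where
      fromAny : Any (λ ℓ → proj₂ ℓ ≡ true × proj₁ ℓ ≢ j) L → OtherPositive j L
      fromAny any with find any
      ... | (i , .true) , i∈L , refl , i≢j = i , i≢j , i∈L
      toAny : OtherPositive j L → Any (λ ℓ → proj₂ ℓ ≡ true × proj₁ ℓ ≢ j) L
      toAny (i , i≢j , i∈L) = lose i∈L (refl , i≢j)

    none-satisfies : ∀ {j L} → ¬ OtherPositive j L → (j , true) ∉ L → All (LitTrue (λ _ → false)) L
    none-satisfies {j} {L} noOther j∉L = All.tabulate false-on
      where
      false-on : ∀ {ℓ} → ℓ ∈ L → LitTrue (λ _ → false) ℓ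
      false-on {x , false} _ = refl
      false-on {x , true} x∈L with x Fin.≟ j
      ... | yes refl = contradiction x∈L j∉L
      ... | no x≢j = contradiction (x , x≢j , x∈L) noOther

    only-satisfies : ∀ {j L} → ¬ OtherPositive j L → (j , false) ∉ L → All (LitTrue (only j)) L
    only-satisfies {j} {L} noOther j∉L = All.tabulate only-on
      where
      only-on : ∀ {ℓ} → ℓ ∈ L → LitTrue (only j) ℓ
      only-on {x , b} x∈L with x Fin.≟ j | b
      ... | yes refl | true  = refl
      ... | yes refl | false = contradiction x∈L j∉L
      ... | no x≢j   | true  = contradiction (x , x≢j , x∈L) noOther
      ... | no x≢j   | false = refl

  module _ (L : List (Lit (Fin n))) where

    private
      ψ : CNF (Var n m)
      ψ = addUnits φ (map liftLit L)

      unit∈ψ : ∀ {ℓ} → ℓ ∈ L → [ liftLit ℓ ] ∈ ψ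
      unit∈ψ ℓ∈L = ∈-++⁺ʳ φ (∈-map⁺ [_] (∈-map⁺ liftLit ℓ∈L))

      propagates-from : ∀ {i j} → (i , true) ∈ L → i ≢ j → UP⊢ ψ (inj₁ j , false)
      propagates-from {i} i∈L i≢j = UP⊢-mono ⊆ψ (propagates i≢j)
        where
        ⊆ψ : φ ++ [ [ (inj₁ i , true) ] ] ⊆ ψ
        ⊆ψ C∈ with ∈-++⁻ φ C∈
        ... | inj₁ C∈φ = ∈-++⁺ˡ C∈φ
        ... | inj₂ (here refl) = unit∈ψ i∈L

      holds-under : ∀ {ℓ} τ → AtMostOne n τ → All (LitTrue τ) L →
                    Entails φ (map liftLit L) (liftLit ℓ) → LitTrue τ ℓ
      holds-under {_ , _} τ amo L-true entails with extends τ amo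
      ... | β , sat = entails Sum.[ τ , β ] sat (All.map⁺ (All.map (λ { {_ , _} τx≡b → τx≡b }) L-true))

    -- If unit propagation derives neither ℓ nor a conflict, then one of the assignments
    -- λ _ → false, only j, only i satisfies L but falsifies ℓ.
    PropagationComplete-AtMostOne-at : ∀ ℓ → Entails φ (map liftLit L) (liftLit ℓ) → UP⊢ ψ (liftLit ℓ) ⊎ UP⊢□ ψ
    PropagationComplete-AtMostOne-at ℓ entails with ℓ ∈? L
    ... | yes ℓ∈L = inj₁ (UP⊢-unit (unit∈ψ ℓ∈L))
    PropagationComplete-AtMostOne-at (j , false) entails | no j∉L with otherPositive? j L
    ... | yes (i , i≢j , i∈L) = inj₁ (propagates-from i∈L i≢j)
    ... | no noOther = contradiction (holds-under (only j) (only-AtMostOne j) (only-satisfies noOther j∉L) entails)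
                                     λ onlyj≡false → contradiction (trans (sym (only-self j)) onlyj≡false) λ ()
    PropagationComplete-AtMostOne-at (j , true) entails | no j∉L with otherPositive? j L
    ... | no noOther = contradiction (holds-under (λ _ → false) (λ _ _ ()) (none-satisfies noOther j∉L) entails) λ ()
    ... | yes (i , i≢j , i∈L) with otherPositive? i L | (i , false) ∈? L
    ...   | yes (k , k≢i , k∈L) | _ = inj₂ (UP⊢□-unit (unit∈ψ k∈L) (propagates-from i∈L (k≢i ∘ sym)))
    ...   | no _ | yes ¬i∈L = inj₂ (UP⊢□-unit (unit∈ψ ¬i∈L) (UP⊢-unit (unit∈ψ i∈L)))
    ...   | no noOther′ | no ¬i∉L =
      contradiction (only-true (holds-under (only i) (only-AtMostOne i) (only-satisfies noOther′ ¬i∉L) entails))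
                    (i≢j ∘ sym)

  PropagationComplete-AtMostOne : PropagationComplete φ
  PropagationComplete-AtMostOne L = PropagationComplete-AtMostOne-at L

-- Ladders

Avoids : ∀ {A : Set} → A → A × A → Set
Avoids z (a , b) = z ≢ a × z ≢ b

module Ladder {V : Set} (v p₁ p₂ : ℕ → V) where

  -- p₁ t (resp. p₂ t) states that at least one (resp. two) of v 0 , … , v t are true.
  rung : ℕ → CNF V
  rung zero    = [ v 0 ⇒ p₁ 0 ]
  rung (suc t) = v (suc t) ⇒ p₁ (suc t)
               ∷ p₁ t ⇒ p₁ (suc t)
               ∷ p₂ t ⇒ p₂ (suc t)
               ∷ ((v (suc t) , false) ∷ (p₁ t , false) ∷ (p₂ (suc t) , true) ∷ [])
               ∷ ((v (suc t) , false) ∷ (p₂ t , false) ∷ [])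
               ∷ []

  ladder : ℕ → CNF V
  ladder zero    = []
  ladder (suc L) = ladder L ++ rung L

  length-ladder : ∀ L → length (ladder L) ≤ 5 * L
  length-ladder zero    = z≤n
  length-ladder (suc L) = begin
    length (ladder L ++ rung L)        ≡⟨ length-++ (ladder L) ⟩
    length (ladder L) + length (rung L) ≤⟨ ℕ.+-mono-≤ (length-ladder L) (length-rung L) ⟩
    5 * L + 5                           ≡⟨ ℕ.+-comm (5 * L) 5 ⟩
    5 + 5 * L                           ≡⟨ ℕ.*-suc 5 L ⟨
    5 * suc L                           ∎
    where
    open ≤-Reasoning
    length-rung : ∀ t → length (rung t) ≤ 5
    length-rung zero    = s≤s z≤n
    length-rung (suc t) = ≤-refl

  ladder-negative : ∀ L → All HasNegative (ladder L)
  ladder-negative zero    = []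
  ladder-negative (suc L) = All.++⁺ (ladder-negative L) (rung-negative L)
    where
    rung-negative : ∀ t → All HasNegative (rung t)
    rung-negative zero    = here refl ∷ []
    rung-negative (suc t) = here refl ∷ here refl ∷ here refl ∷ here refl ∷ here refl ∷ []

  rung⊆ladder : ∀ {t L} → t < L → rung t ⊆ ladder L
  rung⊆ladder {t} {suc L} t<1+L with ℕ.m≤n⇒m<n∨m≡n (≤-pred t<1+L)
  ... | inj₁ t<L  = ∈-++⁺ˡ ∘ rung⊆ladder t<L
  ... | inj₂ refl = ∈-++⁺ʳ (ladder L)

  module _ {L : ℕ} {ψ : CNF V} (ladder⊆ψ : ladder L ⊆ ψ) where

    private
      pred-< : ∀ {t} → suc t < L → t < L
      pred-< = ≤-trans (n≤1+n _)

      mark∈ : ∀ {t} → t < L → (v t ⇒ p₁ t) ∈ ψ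
      mark∈ {zero}  t<L = ladder⊆ψ (rung⊆ladder t<L (here refl))
      mark∈ {suc t} t<L = ladder⊆ψ (rung⊆ladder t<L (here refl))

      carry₁∈ : ∀ {t} → suc t < L → (p₁ t ⇒ p₁ (suc t)) ∈ ψ
      carry₁∈ t<L = ladder⊆ψ (rung⊆ladder t<L (there (here refl)))

      carry₂∈ : ∀ {t} → suc t < L → (p₂ t ⇒ p₂ (suc t)) ∈ ψ
      carry₂∈ t<L = ladder⊆ψ (rung⊆ladder t<L (there (there (here refl))))

      second∈ : ∀ {t} → suc t < L → ((v (suc t) , false) ∷ (p₁ t , false) ∷ (p₂ (suc t) , true) ∷ []) ∈ ψ
      second∈ t<L = ladder⊆ψ (rung⊆ladder t<L (there (there (there (here refl)))))

      overflow∈ : ∀ {t} → suc t < L → ((v (suc t) , false) ∷ (p₂ t , false) ∷ []) ∈ ψ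
      overflow∈ t<L = ladder⊆ψ (rung⊆ladder t<L (there (there (there (there (here refl))))))

      forward : ∀ {p : ℕ → V} → (∀ {t} → suc t < L → (p t ⇒ p (suc t)) ∈ ψ) →
                ∀ {u t} → u ≤′ t → t < L → UP⊢ ψ (p u , true) → UP⊢ ψ (p t , true)
      forward carry ≤′-refl         _   pu = pu
      forward carry (≤′-step u≤′t) t<L pu = modus-ponens (carry t<L) (forward carry u≤′t (pred-< t<L) pu)

      backward : ∀ {p : ℕ → V} → (∀ {t} → suc t < L → (p t ⇒ p (suc t)) ∈ ψ) →
                 ∀ {t u} → t ≤′ u → u < L → UP⊢ ψ (p u , false) → UP⊢ ψ (p t , false)
      backward carry ≤′-refl         _   ¬pu = ¬pu
      backward carry (≤′-step t≤′u) u<L ¬pu = backward carry t≤′u (pred-< u<L) (modus-tollens (carry u<L) ¬pu)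

    private
      module Excludes {u₁ u} (u₁≤u : u₁ ≤ u) (u₂<L : suc u < L)
                      (vu₁ : UP⊢ ψ (v u₁ , true)) (vu₂ : UP⊢ ψ (v (suc u) , true)) where

        p₁-after : ∀ {t} → u₁ ≤ t → t < L → UP⊢ ψ (p₁ t , true)
        p₁-after u₁≤t t<L =
          forward carry₁∈ (≤⇒≤′ u₁≤t) t<L (modus-ponens (mark∈ (ℕ.≤-<-trans u₁≤u (pred-< u₂<L))) vu₁)

        p₂-after : ∀ {t} → suc u ≤ t → t < L → UP⊢ ψ (p₂ t , true)
        p₂-after u₂≤t t<L = forward carry₂∈ (≤⇒≤′ u₂≤t) t<L
          (propagate (second∈ u₂<L) (there (there (here refl))) (vu₂ ∷ p₁-after u₁≤u (pred-< u₂<L) ∷ []))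

        ¬p₂-before : ∀ {t} → t ≤ u → UP⊢ ψ (p₂ t , false)
        ¬p₂-before t≤u = backward carry₂∈ (≤⇒≤′ t≤u) (pred-< u₂<L)
          (propagate (overflow∈ u₂<L) (there (here refl)) (vu₂ ∷ []))

        ¬p₁-before : ∀ {t} → t < u₁ → UP⊢ ψ (p₁ t , false)
        ¬p₁-before {t} (s≤s t≤u₀) = backward carry₁∈ (≤⇒≤′ t≤u₀) (pred-< u₁<L)
          (propagate (second∈ u₁<L) (there (here refl)) (vu₁ ∷ ¬p₂-before u₁≤u ∷ []))
          where
          u₁<L = ℕ.≤-<-trans u₁≤u (pred-< u₂<L)

        excludes : ∀ {c} → c < L → c ≢ u₁ → c ≢ suc u → UP⊢ ψ (v c , false)
        excludes {c} c<L c≢u₁ c≢u₂ with <-cmp c u₁ | <-cmp c (suc u)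
        ... | tri≈ _ c≡u₁ _ | _ = contradiction c≡u₁ c≢u₁
        ... | _ | tri≈ _ c≡u₂ _ = contradiction c≡u₂ c≢u₂
        ... | tri< c<u₁ _ _ | _ = modus-tollens (mark∈ c<L) (¬p₁-before c<u₁)
        ... | tri> _ _ (s≤s u₁≤c′) | tri< (s≤s c′≤u) _ _ =
          propagate (second∈ c<L) (here refl) (p₁-after u₁≤c′ (pred-< c<L) ∷ ¬p₂-before c′≤u ∷ [])
        ... | _ | tri> _ _ (s≤s u₂≤c′) = propagate (overflow∈ c<L) (here refl) (p₂-after u₂≤c′ (pred-< c<L) ∷ [])

    ladder-excludes : ∀ {u₁ u₂} → u₁ ≢ u₂ → u₁ < L → u₂ < L → UP⊢ ψ (v u₁ , true) → UP⊢ ψ (v u₂ , true) →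
                      ∀ {c} → c < L → Avoids c (u₁ , u₂) → UP⊢ ψ (v c , false)
    ladder-excludes {u₁} {u₂} u₁≢u₂ u₁<L u₂<L vu₁ vu₂ c<L (c≢u₁ , c≢u₂) with <-cmp u₁ u₂
    ... | tri≈ _ u₁≡u₂ _ = contradiction u₁≡u₂ u₁≢u₂
    ... | tri< (s≤s u₁≤u) _ _ = Excludes.excludes u₁≤u u₂<L vu₁ vu₂ c<L c≢u₁ c≢u₂
    ... | tri> _ _ (s≤s u₂≤u) = Excludes.excludes u₂≤u u₁<L vu₂ vu₁ c<L c≢u₂ c≢u₁

  module _ {L : ℕ} {α : V → Bool} {u₁ u₂ : ℕ}
           (v-marked : ∀ {t} → t < L → α (v t) ≡ true → t ≡ u₁ ⊎ t ≡ u₂)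
           (p₁-spec : ∀ {t} → t < L → α (p₁ t) ≡ true ⇔ (u₁ ≤ t ⊎ u₂ ≤ t))
           (p₂-spec : ∀ {t} → t < L → α (p₂ t) ≡ true ⇔ (u₁ ≤ t × u₂ ≤ t)) where

    private
      marked-reached : ∀ {t} → t ≡ u₁ ⊎ t ≡ u₂ → u₁ ≤ t ⊎ u₂ ≤ t
      marked-reached (inj₁ refl) = inj₁ ≤-refl
      marked-reached (inj₂ refl) = inj₂ ≤-refl

      second-mark : ∀ {t} → suc t ≡ u₁ ⊎ suc t ≡ u₂ → u₁ ≤ t ⊎ u₂ ≤ t → u₁ ≤ suc t × u₂ ≤ suc t
      second-mark (inj₁ refl) (inj₁ u₁≤t) = contradiction u₁≤t ℕ.1+n≰n
      second-mark (inj₁ refl) (inj₂ u₂≤t) = ≤-refl , ℕ.m≤n⇒m≤1+n u₂≤t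
      second-mark (inj₂ refl) (inj₁ u₁≤t) = ℕ.m≤n⇒m≤1+n u₁≤t , ≤-refl
      second-mark (inj₂ refl) (inj₂ u₂≤t) = contradiction u₂≤t ℕ.1+n≰n

      no-third-mark : ∀ {t} → suc t ≡ u₁ ⊎ suc t ≡ u₂ → ¬ (u₁ ≤ t × u₂ ≤ t)
      no-third-mark (inj₁ refl) (u₁≤t , _) = ℕ.1+n≰n u₁≤t
      no-third-mark (inj₂ refl) (_ , u₂≤t) = ℕ.1+n≰n u₂≤t

      rung-sat : ∀ {t} → t < L → Sat α (rung t)
      rung-sat {zero} t<L = SatClause-⇒ (from (p₁-spec t<L) ∘ marked-reached ∘ v-marked t<L) ∷ []
        where open Equivalence
      rung-sat {suc t} 1+t<L =
        SatClause-⇒ (from (p₁-spec 1+t<L) ∘ marked-reached ∘ v-marked 1+t<L) ∷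
        SatClause-⇒ (from (p₁-spec 1+t<L) ∘ Sum.map step step ∘ to (p₁-spec t<L)) ∷
        SatClause-⇒ (from (p₂-spec 1+t<L) ∘ Product.map step step ∘ to (p₂-spec t<L)) ∷
        second ∷ overflow ∷ []
        where
        open Equivalence
        t<L = ≤-trans (n≤1+n _) 1+t<L
        step : ∀ {u} → u ≤ t → u ≤ suc t
        step = ℕ.m≤n⇒m≤1+n
        second : SatClause α ((v (suc t) , false) ∷ (p₁ t , false) ∷ (p₂ (suc t) , true) ∷ [])
        second with α (v (suc t)) in vt | α (p₁ t) in p₁t
        ... | false | _     = here vt
        ... | true  | false = there (here p₁t)
        ... | true  | true  =
          there (there (here (from (p₂-spec 1+t<L) (second-mark (v-marked 1+t<L vt) (to (p₁-spec t<L) p₁t)))))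
        overflow : SatClause α ((v (suc t) , false) ∷ (p₂ t , false) ∷ [])
        overflow with α (v (suc t)) in vt | α (p₂ t) in p₂t
        ... | false | _     = here vt
        ... | true  | false = there (here p₂t)
        ... | true  | true  = contradiction (to (p₂-spec t<L) p₂t) (no-third-mark (v-marked 1+t<L vt))

    ladder-sat : Sat α (ladder L)
    ladder-sat = prefix-sat ≤-refl
      where
      prefix-sat : ∀ {K} → K ≤ L → Sat α (ladder K)
      prefix-sat {zero}  _   = []
      prefix-sat {suc K} K<L = All.++⁺ (prefix-sat (≤-trans (n≤1+n K) K<L)) (rung-sat K<L)

-- Ordered pairs from distinct blocks

module _ {I A : Set} (_≟_ : DecidableEquality A) (key : A → ℕ) {e : I → A × A}
         (e-injective : ∀ {i j} → e i ≡ e j → i ≡ j)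
         (e-increasing : ∀ i → key (proj₁ (e i)) < key (proj₂ (e i))) where

  private
    locate : ∀ z (p : A × A) → Avoids z p ⊎ (z ≡ proj₁ p ⊎ z ≡ proj₂ p)
    locate z (a , b) with z ≟ a | z ≟ b
    ... | yes z≡a | _       = inj₂ (inj₁ z≡a)
    ... | no _    | yes z≡b = inj₂ (inj₂ z≡b)
    ... | no z≢a  | no z≢b  = inj₁ (z≢a , z≢b)

    endpoints-distinct : ∀ i → proj₁ (e i) ≢ proj₂ (e i)
    endpoints-distinct i a≡b = <-irrefl (cong key a≡b) (e-increasing i)

  some-endpoint-avoids : ∀ {i j} → i ≢ j → Avoids (proj₁ (e j)) (e i) ⊎ Avoids (proj₂ (e j)) (e i)
  some-endpoint-avoids {i} {j} i≢j with locate (proj₁ (e j)) (e i) | locate (proj₂ (e j)) (e i)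
  ... | inj₁ avoids | _ = inj₁ avoids
  ... | inj₂ _ | inj₁ avoids = inj₂ avoids
  ... | inj₂ (inj₁ aⱼ≡aᵢ) | inj₂ (inj₁ bⱼ≡aᵢ) = contradiction (trans aⱼ≡aᵢ (sym bⱼ≡aᵢ)) (endpoints-distinct j)
  ... | inj₂ (inj₂ aⱼ≡bᵢ) | inj₂ (inj₂ bⱼ≡bᵢ) = contradiction (trans aⱼ≡bᵢ (sym bⱼ≡bᵢ)) (endpoints-distinct j)
  ... | inj₂ (inj₁ aⱼ≡aᵢ) | inj₂ (inj₂ bⱼ≡bᵢ) = contradiction (e-injective (cong₂ _,_ aⱼ≡aᵢ bⱼ≡bᵢ)) (i≢j ∘ sym)
  ... | inj₂ (inj₂ aⱼ≡bᵢ) | inj₂ (inj₁ bⱼ≡aᵢ) =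
    ⊥-elim (ℕ.<-asym (e-increasing i) (subst₂ (λ a b → key a < key b) aⱼ≡bᵢ bⱼ≡aᵢ (e-increasing j)))

module OrderedPairs {C : Set} {k : ℕ} (cellPair : Fin k ↣ (C × C)) where

  open Injection cellPair using (to; injective)

  Pair : ℕ → Set
  Pair P = (Fin P × C) × (Fin P × C)

  Increasing : ∀ {P} → Pair P → Set
  Increasing ((B₁ , _) , (B₂ , _)) = B₁ Fin.< B₂

  pairCount : ℕ → ℕ
  pairCount zero    = 0
  pairCount (suc P) = pairCount P + P * k

  private
    weaken : ∀ {P} → Pair P → Pair (suc P)
    weaken ((B₁ , c₁) , (B₂ , c₂)) = (Fin.inject₁ B₁ , c₁) , (Fin.inject₁ B₂ , c₂)

    place : ∀ {P} → Fin P × (C × C) → Pair (suc P)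
    place {P} (B , c₁ , c₂) = (Fin.inject₁ B , c₁) , (Fin.fromℕ P , c₂)

    newest : ∀ P → Fin (P * k) → Pair (suc P)
    newest P = place ∘ Product.map₂ to ∘ Fin.remQuot k

    weaken-injective : ∀ {P} {p q : Pair P} → weaken p ≡ weaken q → p ≡ q
    weaken-injective eq =
      cong₂ _,_ (cong₂ _,_ (Fin.inject₁-injective (cong (proj₁ ∘ proj₁) eq)) (cong (proj₂ ∘ proj₁) eq))
                (cong₂ _,_ (Fin.inject₁-injective (cong (proj₁ ∘ proj₂) eq)) (cong (proj₂ ∘ proj₂) eq))

    newest-injective : ∀ P {i j} → newest P i ≡ newest P j → i ≡ j
    newest-injective P eq = Injection.injective (↔⇒↣ (Fin.*↔× {P} {k}))
      (cong₂ _,_ (Fin.inject₁-injective (cong (proj₁ ∘ proj₁) eq))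
                 (injective (cong₂ _,_ (cong (proj₂ ∘ proj₁) eq) (cong (proj₂ ∘ proj₂) eq))))

  pair : ∀ P → Fin (pairCount P) → Pair P
  pair (suc P) = Sum.[ weaken ∘ pair P , newest P ] ∘ Fin.splitAt (pairCount P)

  pair-increasing : ∀ P i → Increasing (pair P i)
  pair-increasing (suc P) i with Fin.splitAt (pairCount P) i
  ... | inj₁ j = subst₂ ℕ._<_ (sym (Fin.toℕ-inject₁ _)) (sym (Fin.toℕ-inject₁ _)) (pair-increasing P j)
  ... | inj₂ j = subst₂ ℕ._<_ (sym (Fin.toℕ-inject₁ _)) (sym (Fin.toℕ-fromℕ P)) (Fin.toℕ<n (proj₁ (Fin.remQuot k j)))

  pair-injective : ∀ P {i j} → pair P i ≡ pair P j → i ≡ j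
  pair-injective (suc P) {i} {j} eq = Injection.injective (↔⇒↣ (Fin.+↔⊎ {pairCount P} {P * k}))
    (split-injective (Fin.splitAt (pairCount P) i) (Fin.splitAt (pairCount P) j) eq)
    where
    split-injective : ∀ x y → Sum.[ weaken ∘ pair P , newest P ] x ≡ Sum.[ weaken ∘ pair P , newest P ] y → x ≡ y
    split-injective (inj₁ x) (inj₁ y) eq = cong inj₁ (pair-injective P (weaken-injective eq))
    split-injective (inj₂ x) (inj₂ y) eq = cong inj₂ (newest-injective P eq)
    split-injective (inj₁ x) (inj₂ y) eq = contradiction (cong (proj₁ ∘ proj₂) (sym eq)) Fin.fromℕ≢inject₁
    split-injective (inj₂ x) (inj₁ y) eq = contradiction (cong (proj₁ ∘ proj₂) eq) Fin.fromℕ≢inject₁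

  pairCount-lower : ∀ q → q * q * k ≤ 2 * pairCount (suc q)
  pairCount-lower zero    = z≤n
  pairCount-lower (suc q) = begin
    suc q * suc q * k                       ≤⟨ ℕ.m≤m+n _ k ⟩
    suc q * suc q * k + k                   ≡⟨ square-step q k ⟨
    q * q * k + 2 * (suc q * k)             ≤⟨ ℕ.+-monoˡ-≤ _ (pairCount-lower q) ⟩
    2 * pairCount (suc q) + 2 * (suc q * k) ≡⟨ ℕ.*-distribˡ-+ 2 (pairCount (suc q)) _ ⟨
    2 * pairCount (suc (suc q))             ∎
    where
    open ≤-Reasoning
    square-step : ∀ q k → q * q * k + 2 * (suc q * k) ≡ suc q * suc q * k + k
    square-step = solve-∀

-- The encoding

Cell : ℕ → Set
Cell w = Fin w × Fin w

cellPairs : ∀ w → Fin ((w * w) * (w * w)) ↔ (Cell w × Cell w)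
cellPairs w = ↔-trans Fin.*↔× (Fin.*↔× ×-↔ Fin.*↔×)

module CellPairs (w : ℕ) = OrderedPairs (↔⇒↣ (cellPairs w))

module Encoding (g w : ℕ) .{{_ : NonZero (g * w)}} where

  Y : Set
  Y = Fin g × Cell w

  _≟Y_ : DecidableEquality Y
  _≟Y_ = ≡-dec Fin._≟_ (≡-dec Fin._≟_ Fin._≟_)

  cells : Fin (g * (w * w)) ↔ Y
  cells = ↔-trans Fin.*↔× (↔-refl ×-↔ Fin.*↔×)

  L : ℕ
  L = g * w

  rowPosition columnPosition : Y → ℕ
  rowPosition (B , r , _) = toℕ (Fin.combine B r)
  columnPosition (B , _ , c) = toℕ (Fin.combine B c)

  private
    combine-injective : ∀ {B B′ : Fin g} {r r′ : Fin w} →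
                        toℕ (Fin.combine B r) ≡ toℕ (Fin.combine B′ r′) → B ≡ B′ × r ≡ r′
    combine-injective = Fin.combine-injective _ _ _ _ ∘ Fin.toℕ-injective

    columnPosition-avoids : ∀ {z a b : Y} → rowPosition z ≡ rowPosition a → z ≢ a → proj₁ a ≢ proj₁ b →
                       Avoids (columnPosition z) (columnPosition a , columnPosition b)
    columnPosition-avoids {Bz , rz , cz} {Ba , ra , ca} {Bb , _ , _} zA≡aA z≢a Ba≢Bb with combine-injective zA≡aA
    ... | refl , refl = zB≢aB , zB≢bB
      where
      zB≢aB : toℕ (Fin.combine Bz cz) ≢ toℕ (Fin.combine Ba ca)
      zB≢aB zB≡aB = z≢a (cong (λ c → Bz , rz , c) (proj₂ (combine-injective zB≡aB)))
      zB≢bB : toℕ (Fin.combine Bz cz) ≢ toℕ (Fin.combine Bb _)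
      zB≢bB zB≡bB = Ba≢Bb (proj₁ (combine-injective zB≡bB))

  rowPosition-block : ∀ {z z′ : Y} → rowPosition z ≡ rowPosition z′ → proj₁ z ≡ proj₁ z′
  rowPosition-block = proj₁ ∘ combine-injective

  columnPosition-block : ∀ {z z′ : Y} → columnPosition z ≡ columnPosition z′ → proj₁ z ≡ proj₁ z′
  columnPosition-block = proj₁ ∘ combine-injective

  positions-separate : ∀ {a b z : Y} → proj₁ a ≢ proj₁ b → Avoids z (a , b) →
                       Avoids (rowPosition z) (rowPosition a , rowPosition b)
                       ⊎ Avoids (columnPosition z) (columnPosition a , columnPosition b)
  positions-separate {a} {b} {z} a≢b (z≢a , z≢b)
    with rowPosition z ℕ.≟ rowPosition a | rowPosition z ℕ.≟ rowPosition b
  ... | yes zA≡aA | _         = inj₂ (columnPosition-avoids {z} {a} {b} zA≡aA z≢a a≢b)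
  ... | no _      | yes zA≡bA = inj₂ (Product.swap (columnPosition-avoids {z} {b} {a} zA≡bA z≢b (a≢b ∘ sym)))
  ... | no zA≢aA  | no zA≢bA  = inj₁ (zA≢aA , zA≢bA)

  LadderVar : Set
  LadderVar = Fin L ⊎ (Fin L ⊎ Fin L)

  Aux : Set
  Aux = Y ⊎ (LadderVar ⊎ LadderVar)

  auxCount : ℕ
  auxCount = g * (w * w) + ((L + (L + L)) + (L + (L + L)))

  aux↔ : Aux ↔ Fin auxCount
  aux↔ = ↔-sym (↔-trans Fin.+↔⊎ (cells ⊎-↔ ↔-trans Fin.+↔⊎ (ladderVars ⊎-↔ ladderVars)))
    where
    ladderVars : Fin (L + (L + L)) ↔ LadderVar
    ladderVars = ↔-trans Fin.+↔⊎ (↔-refl ⊎-↔ Fin.+↔⊎)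

  -- Ladders index their variables by ℕ but only use positions below L, where clamp is the identity.
  clamp : ℕ → Fin L
  clamp t = t mod L

  toℕ-clamp : ∀ {t} → t < L → toℕ (clamp t) ≡ t
  toℕ-clamp t<L = trans (Fin.toℕ-fromℕ< _) (m<n⇒m%n≡m t<L)

  indicator : ∀ {P : ℕ → Set} → (∀ t → Dec (P t)) → Fin L → Bool
  indicator P? f = does (P? (toℕ f))

  indicator-clamp : ∀ {P : ℕ → Set} (P? : ∀ t → Dec (P t)) {t} → t < L → indicator P? (clamp t) ≡ true ⇔ P t
  indicator-clamp {P} P? {t} t<L = subst (λ s → indicator P? (clamp t) ≡ true ⇔ P s) (toℕ-clamp t<L) (does⇔ (P? _))

  marked? : ∀ u₁ u₂ t → Dec (t ≡ u₁ ⊎ t ≡ u₂)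
  marked? u₁ u₂ t = (t ℕ.≟ u₁) ⊎-dec (t ℕ.≟ u₂)

  reached₁? : ∀ u₁ u₂ t → Dec (u₁ ≤ t ⊎ u₂ ≤ t)
  reached₁? u₁ u₂ t = (u₁ ℕ.≤? t) ⊎-dec (u₂ ℕ.≤? t)

  reached₂? : ∀ u₁ u₂ t → Dec (u₁ ≤ t × u₂ ≤ t)
  reached₂? u₁ u₂ t = (u₁ ℕ.≤? t) ×-dec (u₂ ℕ.≤? t)

  ladderAssignment : ℕ → ℕ → LadderVar → Bool
  ladderAssignment u₁ u₂ =
    Sum.[ indicator (marked? u₁ u₂) , Sum.[ indicator (reached₁? u₁ u₂) , indicator (reached₂? u₁ u₂) ] ]

  module _ {n : ℕ} where

    x : Fin n → Fin n ⊎ Aux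
    x = inj₁

    y : Y → Fin n ⊎ Aux
    y = inj₂ ∘ inj₁

    module Coordinate (embed : LadderVar → Aux) (position : Y → ℕ) (position<L : ∀ z → position z < L) where

      v p₁ p₂ : ℕ → Fin n ⊎ Aux
      v  = inj₂ ∘ embed ∘ inj₁ ∘ clamp
      p₁ = inj₂ ∘ embed ∘ inj₂ ∘ inj₁ ∘ clamp
      p₂ = inj₂ ∘ embed ∘ inj₂ ∘ inj₂ ∘ clamp

      open Ladder v p₁ p₂ using (ladder; length-ladder; ladder-negative; ladder-excludes; ladder-sat)
      open Inverse cells using (to; from; strictlyInverseˡ)

      cellClauses : CNF (Fin n ⊎ Aux)
      cellClauses = tabulate (λ c → y (to c) ⇒ v (position (to c)))

      clauses : CNF (Fin n ⊎ Aux)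
      clauses = cellClauses ++ ladder L

      cellClause∈ : ∀ z → (y z ⇒ v (position z)) ∈ clauses
      cellClause∈ z =
        ∈-++⁺ˡ (subst (λ z′ → (y z′ ⇒ v (position z′)) ∈ cellClauses) (strictlyInverseˡ z) (∈-tabulate⁺ (from z)))

      excludes : ∀ {ψ a b z} → clauses ⊆ ψ → position a ≢ position b →
                 UP⊢ ψ (y a , true) → UP⊢ ψ (y b , true) →
                 Avoids (position z) (position a , position b) → UP⊢ ψ (y z , false)
      excludes {z = z} ⊆ψ a≢b ya yb avoids = modus-tollens (⊆ψ (cellClause∈ z))
        (ladder-excludes (⊆ψ ∘ ∈-++⁺ʳ cellClauses) a≢b (position<L _) (position<L _)
                         (modus-ponens (⊆ψ (cellClause∈ _)) ya) (modus-ponens (⊆ψ (cellClause∈ _)) yb)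
                         (position<L z) avoids)

      sat : ∀ {α a b} → (∀ {z} → α (y z) ≡ true → z ≡ a ⊎ z ≡ b) →
            (∀ l → α (inj₂ (embed l)) ≡ ladderAssignment (position a) (position b) l) → Sat α clauses
      sat {α} {a} {b} y-marked agree =
        All.++⁺ (All.tabulate⁺ λ _ → SatClause-⇒ (mark-set ∘ y-marked)) (ladder-sat v-marked p₁-spec p₂-spec)
        where
        assignment⇔ : ∀ {l} {P : Set} → ladderAssignment (position a) (position b) l ≡ true ⇔ P →
                      α (inj₂ (embed l)) ≡ true ⇔ P
        assignment⇔ = subst (λ β → β ≡ true ⇔ _) (sym (agree _))
        mark-set : ∀ {z} → z ≡ a ⊎ z ≡ b → α (v (position z)) ≡ true
        mark-set {z} = Equivalence.from (assignment⇔ (indicator-clamp (marked? _ _) (position<L z)))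
                     ∘ Sum.map (cong position) (cong position)
        v-marked : ∀ {t} → t < L → α (v t) ≡ true → t ≡ position a ⊎ t ≡ position b
        v-marked t<L = Equivalence.to (assignment⇔ (indicator-clamp (marked? _ _) t<L))
        p₁-spec : ∀ {t} → t < L → α (p₁ t) ≡ true ⇔ (position a ≤ t ⊎ position b ≤ t)
        p₁-spec t<L = assignment⇔ (indicator-clamp (reached₁? _ _) t<L)
        p₂-spec : ∀ {t} → t < L → α (p₂ t) ≡ true ⇔ (position a ≤ t × position b ≤ t)
        p₂-spec t<L = assignment⇔ (indicator-clamp (reached₂? _ _) t<L)

      negative : All HasNegative clauses
      negative = All.++⁺ (All.tabulate⁺ λ _ → here refl) (ladder-negative L)

      length-clauses : length clauses ≤ g * (w * w) + 5 * L
      length-clauses = begin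
        length clauses                          ≡⟨ length-++ cellClauses ⟩
        length cellClauses + length (ladder L)  ≡⟨ cong (_+ length (ladder L)) (length-tabulate _) ⟩
        g * (w * w) + length (ladder L)         ≤⟨ ℕ.+-monoʳ-≤ (g * (w * w)) (length-ladder L) ⟩
        g * (w * w) + 5 * L                     ∎
        where open ≤-Reasoning

    module Rows = Coordinate (inj₂ ∘ inj₁) rowPosition (λ _ → Fin.toℕ<n _)
    module Columns = Coordinate (inj₂ ∘ inj₂) columnPosition (λ _ → Fin.toℕ<n _)

    module _ (edge : Fin n → Y × Y) (edge-injective : ∀ {i j} → edge i ≡ edge j → i ≡ j)
             (edge-increasing : ∀ i → proj₁ (proj₁ (edge i)) Fin.< proj₁ (proj₂ (edge i))) where

      edgeClauses₁ edgeClauses₂ : CNF (Fin n ⊎ Aux)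
      edgeClauses₁ = tabulate λ i → x i ⇒ y (proj₁ (edge i))
      edgeClauses₂ = tabulate λ i → x i ⇒ y (proj₂ (edge i))

      clauses : CNF (Fin n ⊎ Aux)
      clauses = edgeClauses₁ ++ edgeClauses₂ ++ Rows.clauses ++ Columns.clauses

      private
        edge₁∈ : ∀ i → (x i ⇒ y (proj₁ (edge i))) ∈ clauses
        edge₁∈ i = ∈-++⁺ˡ (∈-tabulate⁺ i)

        edge₂∈ : ∀ i → (x i ⇒ y (proj₂ (edge i))) ∈ clauses
        edge₂∈ i = ∈-++⁺ʳ edgeClauses₁ (∈-++⁺ˡ (∈-tabulate⁺ i))

        rows⊆ : Rows.clauses ⊆ clauses
        rows⊆ = ∈-++⁺ʳ edgeClauses₁ ∘ ∈-++⁺ʳ edgeClauses₂ ∘ ∈-++⁺ˡ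

        columns⊆ : Columns.clauses ⊆ clauses
        columns⊆ = ∈-++⁺ʳ edgeClauses₁ ∘ ∈-++⁺ʳ edgeClauses₂ ∘ ∈-++⁺ʳ Rows.clauses

        blocks-differ : ∀ i → proj₁ (proj₁ (edge i)) ≢ proj₁ (proj₂ (edge i))
        blocks-differ i = ℕ.<⇒≢ (edge-increasing i) ∘ cong toℕ

      module _ {ψ} (⊆ψ : clauses ⊆ ψ) {i} (xᵢ : UP⊢ ψ (x i , true)) where

        private
          a b : Y
          a = proj₁ (edge i)
          b = proj₂ (edge i)

          yₐ : UP⊢ ψ (y a , true)
          yₐ = modus-ponens (⊆ψ (edge₁∈ i)) xᵢ

          y_b : UP⊢ ψ (y b , true)
          y_b = modus-ponens (⊆ψ (edge₂∈ i)) xᵢ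

        y-excluded : ∀ {z} → Avoids z (a , b) → UP⊢ ψ (y z , false)
        y-excluded avoids with positions-separate (blocks-differ i) avoids
        ... | inj₁ avoidsRow =
          Rows.excludes (⊆ψ ∘ rows⊆) (blocks-differ i ∘ rowPosition-block {a} {b}) yₐ y_b avoidsRow
        ... | inj₂ avoidsColumn =
          Columns.excludes (⊆ψ ∘ columns⊆) (blocks-differ i ∘ columnPosition-block {a} {b}) yₐ y_b avoidsColumn

        x-excluded : ∀ {j} → i ≢ j → UP⊢ ψ (x j , false)
        x-excluded i≢j with some-endpoint-avoids _≟Y_ (toℕ ∘ proj₁) edge-injective edge-increasing i≢j
        ... | inj₁ avoids = modus-tollens (⊆ψ (edge₁∈ _)) (y-excluded avoids)
        ... | inj₂ avoids = modus-tollens (⊆ψ (edge₂∈ _)) (y-excluded avoids)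

      propagates : PropagatesAtMostOne clauses
      propagates = x-excluded ∈-++⁺ˡ (UP⊢-unit (∈-++⁺ʳ clauses (here refl)))

      edgeAssignment : Y × Y → Aux → Bool
      edgeAssignment (a , b) = Sum.[ (λ z → does ((z ≟Y a) ⊎-dec (z ≟Y b)))
                                   , Sum.[ ladderAssignment (rowPosition a) (rowPosition b)
                                         , ladderAssignment (columnPosition a) (columnPosition b) ] ]

      edgeAssignment-sat : ∀ {τ i} → (∀ {j} → τ j ≡ true → j ≡ i) → Sat Sum.[ τ , edgeAssignment (edge i) ] clauses
      edgeAssignment-sat {τ} {i} only-i =
        All.++⁺ edges₁ (All.++⁺ edges₂ (All.++⁺ (Rows.sat y-marked λ _ → refl) (Columns.sat y-marked λ _ → refl)))
        where
        α = Sum.[ τ , edgeAssignment (edge i) ]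
        a = proj₁ (edge i)
        b = proj₂ (edge i)
        y-marked : ∀ {z} → α (y z) ≡ true → z ≡ a ⊎ z ≡ b
        y-marked {z} = Equivalence.to (does⇔ ((z ≟Y a) ⊎-dec (z ≟Y b)))
        endpoint-true : ∀ (end : Y × Y → Y) {j} → end (edge i) ≡ a ⊎ end (edge i) ≡ b → j ≡ i →
                        α (y (end (edge j))) ≡ true
        endpoint-true end end≡a∨b refl = Dec.dec-true ((end (edge i) ≟Y a) ⊎-dec (end (edge i) ≟Y b)) end≡a∨b
        edges₁ : Sat α edgeClauses₁
        edges₁ = All.tabulate⁺ λ j → SatClause-⇒ (endpoint-true proj₁ (inj₁ refl) ∘ only-i)
        edges₂ : Sat α edgeClauses₂
        edges₂ = All.tabulate⁺ λ j → SatClause-⇒ (endpoint-true proj₂ (inj₂ refl) ∘ only-i)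

      negative : All HasNegative clauses
      negative = All.++⁺ edges₁ (All.++⁺ edges₂ (All.++⁺ Rows.negative Columns.negative))
        where
        edges₁ : All HasNegative edgeClauses₁
        edges₁ = All.tabulate⁺ λ _ → here refl
        edges₂ : All HasNegative edgeClauses₂
        edges₂ = All.tabulate⁺ λ _ → here refl

      extends : ExtendsAtMostOne clauses
      extends τ amo with Fin.any? (λ i → τ i Bool.≟ true)
      ... | yes (i , τᵢ) = edgeAssignment (edge i) , edgeAssignment-sat (λ τⱼ → amo _ i τⱼ τᵢ)
      ... | no none = (λ _ → false) , Sat-allFalse all-false negative
        where
        all-false : ∀ v → Sum.[ τ , (λ _ → false) ] v ≡ false
        all-false (inj₁ i) = Bool.¬-not (λ τᵢ → none (i , τᵢ))
        all-false (inj₂ _) = refl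

      length-clauses : length clauses ≤ 2 * n + 2 * (g * (w * w)) + 10 * L
      length-clauses = begin
        length clauses
          ≡⟨ length-++ edgeClauses₁ ⟩
        length edgeClauses₁ + length (edgeClauses₂ ++ Rows.clauses ++ Columns.clauses)
          ≡⟨ cong₂ _+_ (length-tabulate (λ i → x i ⇒ y (proj₁ (edge i))))
                       (trans (length-++ edgeClauses₂) (cong₂ _+_ (length-tabulate (λ i → x i ⇒ y (proj₂ (edge i))))
                                                                   (length-++ Rows.clauses))) ⟩
        n + (n + (length Rows.clauses + length Columns.clauses))
          ≤⟨ ℕ.+-monoʳ-≤ n (ℕ.+-monoʳ-≤ n (ℕ.+-mono-≤ Rows.length-clauses Columns.length-clauses)) ⟩
        n + (n + ((g * (w * w) + 5 * L) + (g * (w * w) + 5 * L)))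
          ≡⟨ regroup n (g * (w * w)) L ⟩
        2 * n + 2 * (g * (w * w)) + 10 * L ∎
        where
        open ≤-Reasoning
        regroup : ∀ n G L → n + (n + ((G + 5 * L) + (G + 5 * L))) ≡ 2 * n + 2 * G + 10 * L
        regroup = solve-∀

AtMostOne-encoding : ∀ g w .{{_ : NonZero (g * w)}} n → n ≤ CellPairs.pairCount w g →
  Σ ℕ λ m → Σ (CNF (Var n m)) λ φ →
    Encodes (AtMostOne n) φ × PropagationComplete φ ×
    length φ ≤ 2 * n + 2 * (g * (w * w)) + 10 * (g * w) × m ≡ g * (w * w) + 6 * (g * w)
AtMostOne-encoding g w n n≤pairCount =
  auxCount , φ , Encodes-AtMostOne extends′ propagates′ , PropagationComplete-AtMostOne extends′ propagates′ ,
  subst (_≤ 2 * n + 2 * (g * (w * w)) + 10 * (g * w)) (sym (length-map _ φ′))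
        (length-clauses edge edge-injective edge-increasing) ,
  count
  where
  open Encoding g w
  open CellPairs w using (pair; pair-injective; pair-increasing)

  edge : Fin n → Y × Y
  edge i = pair g (Fin.inject≤ i n≤pairCount)

  edge-injective : ∀ {i j} → edge i ≡ edge j → i ≡ j
  edge-injective = Fin.inject≤-injective _ _ _ _ ∘ pair-injective g

  edge-increasing : ∀ i → proj₁ (proj₁ (edge i)) Fin.< proj₁ (proj₂ (edge i))
  edge-increasing i = pair-increasing g _

  φ′ : CNF (Fin n ⊎ Aux)
  φ′ = clauses edge edge-injective edge-increasing

  φ : CNF (Var n auxCount)
  φ = rename (Sum.map₂ (Inverse.to aux↔)) φ′

  extends′ : ExtendsAtMostOne φ
  extends′ = ExtendsAtMostOne-rename aux↔ (extends edge edge-injective edge-increasing)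

  propagates′ : PropagatesAtMostOne φ
  propagates′ = PropagatesAtMostOne-rename aux↔ (propagates edge edge-injective edge-increasing)

  count : auxCount ≡ g * (w * w) + 6 * (g * w)
  count = regroup (g * (w * w)) (g * w)
    where
    regroup : ∀ G L → G + ((L + (L + L)) + (L + (L + L))) ≡ G + 6 * L
    regroup = solve-∀

-- Choice of the parameters

floor-sqrt : ∀ r → ∃ λ f → f * f ≤ r × r < suc f * suc f
floor-sqrt zero = 0 , z≤n , s≤s z≤n
floor-sqrt (suc r) with floor-sqrt r
... | f , f²≤r , r<[1+f]² with suc r ℕ.<? suc f * suc f
...   | yes 1+r<[1+f]² = f , ≤-trans f²≤r (n≤1+n r) , 1+r<[1+f]²
...   | no 1+r≮[1+f]²  = suc f , ℕ.≮⇒≥ 1+r≮[1+f]² , ℕ.≤-<-trans r<[1+f]² (ℕ.*-mono-< (n<1+n (suc f)) (n<1+n (suc f)))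

sqrt-bracket : ∀ {r} → 1 ≤ r → ∃ λ w → r ≤ suc w * suc w × suc w * suc w ≤ 4 * r
sqrt-bracket {r} 1≤r with floor-sqrt r
... | zero  , _ , r<1 = contradiction (ℕ.<-≤-trans r<1 1≤r) (<-irrefl refl)
... | suc f , [1+f]²≤r , r<[2+f]² = suc f , ℕ.<⇒≤ r<[2+f]² , (begin
  suc (suc f) * suc (suc f) ≤⟨ ℕ.*-mono-≤ 2+f≤2[1+f] 2+f≤2[1+f] ⟩
  (2 * suc f) * (2 * suc f) ≡⟨ square-double (suc f) ⟩
  4 * (suc f * suc f)       ≤⟨ ℕ.*-monoʳ-≤ 4 [1+f]²≤r ⟩
  4 * r                     ∎)
  where
  open ≤-Reasoning
  2+f≤2[1+f] : suc (suc f) ≤ 2 * suc f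
  2+f≤2[1+f] = subst (suc (suc f) ≤_) (double f) (ℕ.m≤m+n (suc (suc f)) f)
    where
    double : ∀ f → suc (suc f) + f ≡ 2 * suc f
    double = solve-∀
  square-double : ∀ x → (2 * x) * (2 * x) ≡ 4 * (x * x)
  square-double = solve-∀

module BlockParameters {n s r w : ℕ} (2n≤s² : 2 * n ≤ s * s) (n≤r³ : n ≤ r * r * r)
                       (r≤h : r ≤ suc w * suc w) (h≤4r : suc w * suc w ≤ 4 * r) where

  open ≤-Reasoning

  W h : ℕ
  W = suc w
  h = W * W

  -- Capping s keeps the number of blocks, hence the length of the ladders, in O(r).
  s′ : ℕ
  s′ = s ⊓ (2 * W * h)

  2n≤s′² : 2 * n ≤ s′ * s′
  2n≤s′² with ℕ.⊓-sel s (2 * W * h)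
  ... | inj₁ s′≡s rewrite s′≡s = 2n≤s²
  ... | inj₂ s′≡2Wh rewrite s′≡2Wh = begin
    2 * n                 ≤⟨ ℕ.*-monoˡ-≤ n (ℕ.m≤m+n 2 2) ⟩
    4 * n                 ≤⟨ ℕ.*-monoʳ-≤ 4 n≤r³ ⟩
    4 * (r * r * r)       ≤⟨ ℕ.*-monoʳ-≤ 4 (ℕ.*-mono-≤ (ℕ.*-mono-≤ r≤h r≤h) r≤h) ⟩
    4 * (h * h * h)       ≡⟨ cube W ⟩
    2 * W * h * (2 * W * h) ∎
    where
    cube : ∀ W → 4 * (W * W * (W * W) * (W * W)) ≡ 2 * W * (W * W) * (2 * W * (W * W))
    cube = solve-∀

  q : ℕ
  q = suc (s′ / h)

  s′≤qh : s′ ≤ q * h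
  s′≤qh = begin
    s′                    ≡⟨ m≡m%n+[m/n]*n s′ h ⟩
    s′ % h + s′ / h * h   ≤⟨ ℕ.+-monoˡ-≤ _ (m%n≤n s′ h) ⟩
    h + s′ / h * h        ∎

  qh≤s′+h : q * h ≤ s′ + h
  qh≤s′+h = begin
    h + s′ / h * h ≤⟨ ℕ.+-monoʳ-≤ h (m/n*n≤m s′ h) ⟩
    h + s′         ≡⟨ ℕ.+-comm h s′ ⟩
    s′ + h         ∎

  n≤pairCount : n ≤ CellPairs.pairCount W (suc q)
  n≤pairCount = ℕ.*-cancelˡ-≤ 2 (begin
    2 * n                            ≤⟨ 2n≤s′² ⟩
    s′ * s′                          ≤⟨ ℕ.*-mono-≤ s′≤qh s′≤qh ⟩
    q * h * (q * h)                  ≡⟨ square-product q h ⟩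
    q * q * (h * h)                  ≤⟨ CellPairs.pairCount-lower W q ⟩
    2 * CellPairs.pairCount W (suc q) ∎)
    where
    square-product : ∀ q h → q * h * (q * h) ≡ q * q * (h * h)
    square-product = solve-∀

  cellCount≤ : suc q * h ≤ s + 8 * r
  cellCount≤ = begin
    h + q * h              ≤⟨ ℕ.+-monoʳ-≤ h qh≤s′+h ⟩
    h + (s′ + h)           ≤⟨ ℕ.+-monoʳ-≤ h (ℕ.+-monoˡ-≤ h (ℕ.m⊓n≤m s _)) ⟩
    h + (s + h)            ≡⟨ regroup s h ⟩
    s + 2 * h              ≤⟨ ℕ.+-monoʳ-≤ s (ℕ.*-monoʳ-≤ 2 h≤4r) ⟩
    s + 2 * (4 * r)        ≡⟨ cong (s +_) (ℕ.*-assoc 2 4 r) ⟨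
    s + 8 * r              ∎
    where
    regroup : ∀ s h → h + (s + h) ≡ s + 2 * h
    regroup = solve-∀

  positionCount≤ : suc q * W ≤ 16 * r
  positionCount≤ = begin
    suc q * W              ≤⟨ ℕ.*-monoˡ-≤ W (s≤s q≤2W+1) ⟩
    (2 + 2 * W) * W        ≡⟨ expand W ⟩
    2 * h + 2 * W          ≤⟨ ℕ.+-monoʳ-≤ (2 * h) (ℕ.*-monoʳ-≤ 2 (ℕ.m≤m*n W W)) ⟩
    2 * h + 2 * h          ≡⟨ regroup h ⟩
    4 * h                  ≤⟨ ℕ.*-monoʳ-≤ 4 h≤4r ⟩
    4 * (4 * r)            ≡⟨ ℕ.*-assoc 4 4 r ⟨
    16 * r                 ∎
    where
    q≤2W+1 : q ≤ 1 + 2 * W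
    q≤2W+1 = ℕ.*-cancelʳ-≤ q (1 + 2 * W) h (begin
      q * h                ≤⟨ qh≤s′+h ⟩
      s′ + h               ≤⟨ ℕ.+-monoˡ-≤ h (ℕ.m⊓n≤n s _) ⟩
      2 * W * h + h        ≡⟨ ℕ.+-comm (2 * W * h) h ⟩
      (1 + 2 * W) * h      ∎)
    expand : ∀ W → (2 + 2 * W) * W ≡ 2 * (W * W) + 2 * W
    expand = solve-∀
    regroup : ∀ h → 2 * h + 2 * h ≡ 4 * h
    regroup = solve-∀

block-parameters : ∀ n s r → 1 ≤ n → 2 * n ≤ s * s → n ≤ r * r * r →
  ∃₂ λ q w → n ≤ CellPairs.pairCount (suc w) (suc q)
           × suc q * (suc w * suc w) ≤ s + 8 * r × suc q * suc w ≤ 16 * r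
block-parameters n s zero 1≤n _ n≤0 = contradiction (≤-trans 1≤n n≤0) λ ()
block-parameters n s (suc r) _ 2n≤s² n≤r³ with sqrt-bracket {suc r} (s≤s z≤n)
... | w , r≤h , h≤4r = q , w , n≤pairCount , cellCount≤ , positionCount≤
  where open BlockParameters {s = s} {w = w} 2n≤s² n≤r³ r≤h h≤4r

clause-bound : ∀ n s r {G L} → G ≤ s + 8 * r → L ≤ 16 * r → 2 * n + 2 * G + 10 * L ≤ 2 * n + 2 * s + 176 * r
clause-bound n s r {G} {L} G≤ L≤ = begin
  2 * n + 2 * G + 10 * L                   ≤⟨ ℕ.+-mono-≤ (ℕ.+-monoʳ-≤ (2 * n) (ℕ.*-monoʳ-≤ 2 G≤)) (ℕ.*-monoʳ-≤ 10 L≤) ⟩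
  2 * n + 2 * (s + 8 * r) + 10 * (16 * r)  ≡⟨ regroup n s r ⟩
  2 * n + 2 * s + 176 * r                  ∎
  where
  open ≤-Reasoning
  regroup : ∀ n s r → 2 * n + 2 * (s + 8 * r) + 10 * (16 * r) ≡ 2 * n + 2 * s + 176 * r
  regroup = solve-∀

variable-bound : ∀ s r {G L} → G ≤ s + 8 * r → L ≤ 16 * r → G + 6 * L ≤ s + 176 * r
variable-bound s r {G} {L} G≤ L≤ = begin
  G + 6 * L                  ≤⟨ ℕ.+-mono-≤ G≤ (ℕ.*-monoʳ-≤ 6 L≤) ⟩
  s + 8 * r + 6 * (16 * r)   ≡⟨ regroup s r ⟩
  s + 104 * r                ≤⟨ ℕ.+-monoʳ-≤ s (ℕ.*-monoˡ-≤ r (ℕ.m≤m+n 104 72)) ⟩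
  s + 176 * r                ∎
  where
  open ≤-Reasoning
  regroup : ∀ s r → s + 8 * r + 6 * (16 * r) ≡ s + 104 * r
  regroup = solve-∀

theorem1 : Σ ℕ λ C → Σ ℕ λ N → (n : ℕ) → N ≤ n →
    (s r : ℕ) → 2 * n ≤ s * s → n ≤ r * r * r →
    Σ ℕ λ m → Σ (CNF (Var n m)) λ φ →
      Encodes (AtMostOne n) φ × PropagationComplete φ
      × length φ ≤ 2 * n + 2 * s + C * r
      × m ≤ s + C * r
theorem1 = 176 , 1 , λ n 1≤n s r 2n≤s² n≤r³ →
  let q , w , n≤pairCount , cellCount≤ , positionCount≤ = block-parameters n s r 1≤n 2n≤s² n≤r³
      m , φ , encodes , complete , length≤ , m≡ = AtMostOne-encoding (suc q) (suc w) n n≤pairCount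
  in m , φ , encodes , complete , ≤-trans length≤ (clause-bound n s r cellCount≤ positionCount≤)
   , subst (_≤ s + 176 * r) (sym m≡) (variable-bound s r cellCount≤ positionCount≤)
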